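{- Let $k\geq 3$, let $G$ be a cylindrical grid of order $k$ (a subgraph of some digraph), and let $P$ be a perimeter jump for $G$. Then $G\cup P$ contains a weak odd bicycle, and hence contains an even dicycle.
   Context: The cylindrical grid of order $k$ is obtained from dicycles $C_1,\dots,C_k$, where $C_i$ has vertices $v^i_0,\dots,v^i_{2k-1}$ and edges $(v^i_j,v^i_{j+1})$ (indices mod $2k$), by adding for each $i\in[0,k-1]$ the directed paths $v^1_{2i}v^2_{2i}\cdots v^k_{2i}$ and $v^k_{2i+1}\cdots v^1_{2i+1}$. A perimeter jump for $G$ is a directed path from $V(C_1)$ to $V(C_k)$ or from $V(C_k)$ to $V(C_1)$ that is internally disjoint from $G$. An edge $(u,v)$ is butterfly-contractible if it is the only outgoing edge of $u$ or the only incoming edge of $v$; a butterfly minor is obtained by vertex deletions, edge deletions and contractions of butterfly-contractible edges. An odd bicycle is the digraph obtained from an undirected cycle of odd length by replacing each edge $uv$ with the two edges $(u,v),(v,u)$. A weak odd bicycle is a subgraph that can be transformed into an odd bicycle by repeated butterfly contractions (a butterfly minor model of an odd bicycle). A dicycle is even if it has an even number of vertices. -}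

module Defs where

open import Data.Nat using (ℕ; zero; suc; _+_; _%_; _≤_)
open import Data.Fin using (Fin; toℕ; inject₁) renaming (zero to fzero; suc to fsuc)
open import Data.Product using (Σ; ∃; ∃-syntax; _×_; _,_; proj₁; proj₂)
open import Data.Sum using (_⊎_)
open import Relation.Nullary using (¬_; yes; no)
open import Relation.Binary.PropositionalEquality using (_≡_; _≢_)
open import Relation.Binary.Definitions using (DecidableEquality)
open import Function.Bundles using (_⇔_)

-- Digraphs inside an ambient vertex type A: a vertex predicate and an
-- edge relation (relation semantics: simple digraphs, no parallel edges).

record Graph (A : Set) : Set₁ where
  field
    vert : A → Set
    edge : A → A → Set
open Graph public

WellFormed : {A : Set} → Graph A → Set
WellFormed {A} H = ∀ (x y : A) → edge H x y → vert H x × vert H y × x ≢ y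

_⊆G_ : {A : Set} → Graph A → Graph A → Set
_⊆G_ {A} H' H = WellFormed H'
  × (∀ (x : A) → vert H' x → vert H x)
  × (∀ (x y : A) → edge H' x y → edge H x y)

CycSucc : (n : ℕ) → Fin n → Fin n → Set
CycSucc n i j = (suc (toℕ i) ≡ toℕ j) ⊎ (suc (toℕ i) ≡ n × toℕ j ≡ 0)

ButterflyContractible : {A : Set} → Graph A → A → A → Set
ButterflyContractible {A} H u v = edge H u v
  × ((∀ (w : A) → edge H u w → w ≡ v) ⊎ (∀ (w : A) → edge H w v → w ≡ u))

-- contracting (u,v): v is merged into u; resulting loops are discarded,
-- parallel edges are merged (relation semantics)
module _ {A : Set} (_≟_ : DecidableEquality A) where

  merge : A → A → A → A
  merge u v x with x ≟ v
  ... | yes _ = u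
  ... | no _ = x

  contract : Graph A → A → A → Graph A
  contract H u v = record
    { vert = λ a → vert H a × a ≢ v
    ; edge = λ a b → a ≢ b × Σ A (λ x → Σ A (λ y →
               edge H x y × merge u v x ≡ a × merge u v y ≡ b))
    }

  data Contracts : Graph A → Graph A → Set₁ where
    done : ∀ H → Contracts H H
    step : ∀ H H'' (u v : A) → u ≢ v → ButterflyContractible H u v
         → Contracts (contract H u v) H'' → Contracts H H''

IsOddBicycle : {A : Set} → Graph A → Set
IsOddBicycle {A} H = Σ ℕ λ m →
  let n = suc (suc (suc (m + m))) in
  Σ (Fin n → A) λ g →
      (∀ i j → g i ≡ g j → i ≡ j)
    × (∀ (x : A) → vert H x ⇔ (∃[ i ] g i ≡ x))
    × (∀ i j → edge H (g i) (g j) ⇔ (CycSucc n i j ⊎ CycSucc n j i))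

ContainsWeakOddBicycle : {A : Set} → DecidableEquality A → Graph A → Set₁
ContainsWeakOddBicycle {A} _≟_ H = Σ (Graph A) λ H' → Σ (Graph A) λ H'' →
  (H' ⊆G H) × Contracts _≟_ H' H'' × IsOddBicycle H''

IsDicycle : {A : Set} → Graph A → (n : ℕ) → (Fin n → A) → Set
IsDicycle {A} H n c = (1 ≤ n)
  × (∀ i j → c i ≡ c j → i ≡ j)
  × (∀ i → vert H (c i))
  × (∀ i j → CycSucc n i j → edge H (c i) (c j))

ContainsEvenDicycle : {A : Set} → Graph A → Set
ContainsEvenDicycle H = Σ ℕ λ m → Σ (Fin (suc m + suc m) → _) λ c →
  IsDicycle H (suc m + suc m) c

-- Cylindrical grid of order k.  Vertex (i , j) stands for v^{i+1}_j.

GridV : ℕ → Set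
GridV k = Fin k × Fin (k + k)

GridE : (k : ℕ) → GridV k → GridV k → Set
GridE k (i , j) (i' , j') =
    (i ≡ i' × CycSucc (k + k) j j')
  ⊎ (j ≡ j' × toℕ j % 2 ≡ 0 × suc (toℕ i) ≡ toℕ i')
  ⊎ (j ≡ j' × toℕ j % 2 ≡ 1 × suc (toℕ i') ≡ toℕ i)

-- a digraph D on vertex set Fin N given by its edge relation
-- φ : a cylindrical grid of order k as a subgraph of D
record GridIn (N : ℕ) (ED : Fin N → Fin N → Set) (k : ℕ) : Set where
  field
    φ     : GridV k → Fin N
    φ-inj : ∀ a b → φ a ≡ φ b → a ≡ b
    φ-edge : ∀ a b → GridE k a b → ED (φ a) (φ b)
open GridIn public

OnC1 : {k : ℕ} → GridV k → Set
OnC1 (i , _) = toℕ i ≡ 0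

OnCk : {k : ℕ} → GridV k → Set
OnCk {k} (i , _) = suc (toℕ i) ≡ k

record PerimeterJump {N : ℕ} {ED : Fin N → Fin N → Set} {k : ℕ}
                     (G : GridIn N ED k) : Set where
  field
    m      : ℕ
    p      : Fin (suc (suc m)) → Fin N
    p-inj  : ∀ i j → p i ≡ p j → i ≡ j
    p-edge : ∀ (i : Fin (suc m)) → ED (p (inject₁ i)) (p (fsuc i))
    p-int  : ∀ (i : Fin m) (a : GridV k) → p (fsuc (inject₁ i)) ≢ φ G a
    p-ends : (Σ (GridV k) λ a → Σ (GridV k) λ b →
                 OnC1 a × OnCk b × φ G a ≡ p fzero × φ G b ≡ p (Data.Fin.fromℕ (suc m)))
           ⊎ (Σ (GridV k) λ a → Σ (GridV k) λ b →
                 OnCk a × OnC1 b × φ G a ≡ p fzero × φ G b ≡ p (Data.Fin.fromℕ (suc m)))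
open PerimeterJump public

GridUnionJump : {N : ℕ} {ED : Fin N → Fin N → Set} {k : ℕ}
                (G : GridIn N ED k) → PerimeterJump G → Graph (Fin N)
GridUnionJump {N} {ED} {k} G P = record
  { vert = λ x → (∃[ a ] φ G a ≡ x) ⊎ (∃[ i ] p P i ≡ x)
  ; edge = λ x y →
      (Σ (GridV k) λ a → Σ (GridV k) λ b → GridE k a b × φ G a ≡ x × φ G b ≡ y)
    ⊎ (Σ (Fin (suc (m P))) λ i → p P (inject₁ i) ≡ x × p P (fsuc i) ≡ y)
  }

{-# OPTIONS --safe #-}
module Submission where

-- In suitable coordinates the jump leaves frame row 0 (which is C₁ or C_k) at frame column
-- 1 or 2 and lands on the last frame row. Inside G ∪ P take three branches hanging off the
-- roots x = (0, last), y = (0, 1) and z = (1, 0), in which every non-root vertex has exactly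
-- one in-neighbour: contracting each such vertex into that neighbour is a butterfly
-- contraction, and doing so branch by branch collapses everything onto {x, y, z}. For every
-- ordered pair of roots, the first root's branch has an edge into the second root, so what
-- remains is the bidirected triangle, an odd bicycle. The even dicycle is C₁, of length 2k.

open import Defs
open import Data.Nat using (ℕ; zero; suc; _+_; _∸_; _≤_; _<_; z≤n; s≤s; _%_; NonZero)
open import Data.Nat.Properties renaming (_≟_ to _≟ℕ_)
open import Data.Nat.DivMod
  using (_mod_; m%n<n; m%n≤n; m<n⇒m%n≡m; [m+kn]%n≡m%n; [m+n]%n≡m%n; %-distribˡ-+; m%n%n≡m%n; n%n≡0; m∣n⇒o%n%m≡o%m)
open import Data.Nat.Divisibility using (_∣_; divides)
open import Data.Fin using (Fin; _≟_; toℕ; inject₁; fromℕ; fromℕ<) renaming (zero to fzero; suc to fsuc)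
open import Data.Fin.Properties using (toℕ-injective; toℕ-fromℕ<; toℕ-inject₁; toℕ-fromℕ; toℕ<n)
open import Data.Product using (Σ; ∃-syntax; _×_; _,_; proj₁; proj₂)
open import Data.Sum using (_⊎_; inj₁; inj₂)
open import Data.Empty using (⊥; ⊥-elim)
open import Data.Unit using (⊤; tt)
open import Data.List using (List; []; _∷_; _++_)
open import Data.List.Membership.Propositional using (_∈_)
open import Data.List.Membership.Propositional.Properties using (∈-++⁺ˡ; ∈-++⁺ʳ)
open import Data.List.Relation.Unary.Any using (Any; here; there; any?)
open import Relation.Nullary using (¬_; Dec; yes; no)
open import Relation.Binary.PropositionalEquality
  using (_≡_; _≢_; refl; sym; trans; cong; cong₂; subst; module ≡-Reasoning)
open import Relation.Binary.Definitions using (DecidableEquality)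
open import Function.Base using (_∘_)
open import Function.Bundles using (_⇔_; mk⇔; Equivalence)

record _≃ᴳ_ {A : Set} (H K : Graph A) : Set where
  field
    vert⇒ : ∀ a → vert H a → vert K a
    vert⇐ : ∀ a → vert K a → vert H a
    edge⇒ : ∀ a b → edge H a b → edge K a b
    edge⇐ : ∀ a b → edge K a b → edge H a b
open _≃ᴳ_

module _ {A : Set} where

  ≃ᴳ-trans : {H K L : Graph A} → H ≃ᴳ K → K ≃ᴳ L → H ≃ᴳ L
  ≃ᴳ-trans p q = record
    { vert⇒ = λ a h → vert⇒ q a (vert⇒ p a h) ; vert⇐ = λ a h → vert⇐ p a (vert⇐ q a h)
    ; edge⇒ = λ a b h → edge⇒ q a b (edge⇒ p a b h) ; edge⇐ = λ a b h → edge⇐ p a b (edge⇐ q a b h) }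

  contractible-resp-≃ᴳ : {H K : Graph A} {u v : A} → H ≃ᴳ K
                       → ButterflyContractible K u v → ButterflyContractible H u v
  contractible-resp-≃ᴳ {u = u} {v} p (e , inj₁ onlyOut) =
    edge⇐ p u v e , inj₁ (λ w uw → onlyOut w (edge⇒ p u w uw))
  contractible-resp-≃ᴳ {u = u} {v} p (e , inj₂ onlyIn) =
    edge⇐ p u v e , inj₂ (λ w wv → onlyIn w (edge⇒ p w v wv))

  isOddBicycle-resp-≃ᴳ : {H K : Graph A} → H ≃ᴳ K → IsOddBicycle K → IsOddBicycle H
  isOddBicycle-resp-≃ᴳ p (m , g , g-inj , verts , edges) = m , g , g-inj ,
    (λ a → mk⇔ (λ h → Equivalence.to (verts a) (vert⇒ p a h))
               (λ h → vert⇐ p a (Equivalence.from (verts a) h))) ,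
    (λ i j → mk⇔ (λ h → Equivalence.to (edges i j) (edge⇒ p _ _ h))
                 (λ h → edge⇐ p _ _ (Equivalence.from (edges i j) h)))

  quotient : Graph A → (A → A) → Graph A
  quotient H σ = record
    { vert = λ a → vert H a × σ a ≡ a
    ; edge = λ a b → a ≢ b × Σ A λ x → Σ A λ y → edge H x y × σ x ≡ a × σ y ≡ b }

  quotient-cong : ∀ H {σ τ : A → A} → (∀ a → σ a ≡ τ a) → quotient H σ ≃ᴳ quotient H τ
  quotient-cong H σ≗τ = record
    { vert⇒ = λ a (h , s) → h , trans (sym (σ≗τ a)) s
    ; vert⇐ = λ a (h , s) → h , trans (σ≗τ a) s
    ; edge⇒ = λ { a b (ne , x , y , e , p , q) → ne , x , y , e , trans (sym (σ≗τ x)) p , trans (sym (σ≗τ y)) q }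
    ; edge⇐ = λ { a b (ne , x , y , e , p , q) → ne , x , y , e , trans (σ≗τ x) p , trans (σ≗τ y) q } }

  quotient-id : ∀ {H} → WellFormed H → H ≃ᴳ quotient H (λ a → a)
  quotient-id {H} wf = record
    { vert⇒ = λ a h → h , refl
    ; vert⇐ = λ a h → proj₁ h
    ; edge⇒ = λ a b e → proj₂ (proj₂ (wf a b e)) , a , b , e , refl , refl
    ; edge⇐ = λ { a b (ne , x , y , e , refl , refl) → e } }

module _ {A : Set} (_≟_ : DecidableEquality A) where

  merge-merged : ∀ u v → merge _≟_ u v v ≡ u
  merge-merged u v with v ≟ v
  ... | yes _ = refl
  ... | no v≢v = ⊥-elim (v≢v refl)

  merge-other : ∀ u v x → x ≢ v → merge _≟_ u v x ≡ x
  merge-other u v x x≢v with x ≟ v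
  ... | yes x≡v = ⊥-elim (x≢v x≡v)
  ... | no _ = refl

  contract-resp-≃ᴳ : ∀ {H K} u v → H ≃ᴳ K → contract _≟_ H u v ≃ᴳ contract _≟_ K u v
  contract-resp-≃ᴳ u v p = record
    { vert⇒ = λ a h → vert⇒ p a (proj₁ h) , proj₂ h
    ; vert⇐ = λ a h → vert⇐ p a (proj₁ h) , proj₂ h
    ; edge⇒ = λ { a b (ne , x , y , e , q , r) → ne , x , y , edge⇒ p x y e , q , r }
    ; edge⇐ = λ { a b (ne , x , y , e , q , r) → ne , x , y , edge⇐ p x y e , q , r } }

  -- Contracting a quotient yields a quotient, so a sequence of contractions is tracked by one map σ.
  contract-quotient : ∀ H σ u v → σ u ≡ u → u ≢ v
                    → contract _≟_ (quotient H σ) u v ≃ᴳ quotient H (λ a → merge _≟_ u v (σ a))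
  contract-quotient H σ u v σu≡u u≢v = record
    { vert⇒ = λ a ((h , σa≡a) , a≢v) → h , trans (cong (merge _≟_ u v) σa≡a) (merge-other u v a a≢v)
    ; vert⇐ = vert⇐′
    ; edge⇒ = λ { a b (ne , x , y , (_ , x' , y' , e , p , q) , r , s) →
        ne , x' , y' , e , trans (cong (merge _≟_ u v) p) r , trans (cong (merge _≟_ u v) q) s }
    ; edge⇐ = λ { a b (ne , x' , y' , e , r , s) →
        ne , σ x' , σ y' , ((λ eq → ne (trans (sym r) (trans (cong (merge _≟_ u v) eq) s))) , x' , y' , e , refl , refl)
           , r , s } }
    where
    vert⇐′ : ∀ a → vert (quotient H (λ a → merge _≟_ u v (σ a))) a → vert (contract _≟_ (quotient H σ) u v) a
    vert⇐′ a (h , fixed) with σ a ≟ v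
    ... | yes σa≡v = ⊥-elim (u≢v (trans (sym σu≡u) (trans (cong σ fixed) σa≡v)))
    ... | no σa≢v = (h , fixed) , λ a≡v → σa≢v (trans fixed a≡v)

cycSucc-irreflexive : ∀ {n} → 2 ≤ n → (i j : Fin n) → CycSucc n i j → i ≢ j
cycSucc-irreflexive _ i .i (inj₁ 1+i≡i) refl = 1+n≢n 1+i≡i
cycSucc-irreflexive (s≤s (s≤s _)) i .i (inj₂ (1+i≡n , i≡0)) refl with trans (sym 1+i≡n) (cong suc i≡0)
... | ()

triangle-adjacent : (i j : Fin 3) → i ≢ j → CycSucc 3 i j ⊎ CycSucc 3 j i
triangle-adjacent fzero fzero i≢j = ⊥-elim (i≢j refl)
triangle-adjacent fzero (fsuc fzero) _ = inj₁ (inj₁ refl)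
triangle-adjacent fzero (fsuc (fsuc fzero)) _ = inj₂ (inj₂ (refl , refl))
triangle-adjacent (fsuc fzero) fzero _ = inj₂ (inj₁ refl)
triangle-adjacent (fsuc fzero) (fsuc fzero) i≢j = ⊥-elim (i≢j refl)
triangle-adjacent (fsuc fzero) (fsuc (fsuc fzero)) _ = inj₁ (inj₁ refl)
triangle-adjacent (fsuc (fsuc fzero)) fzero _ = inj₁ (inj₂ (refl , refl))
triangle-adjacent (fsuc (fsuc fzero)) (fsuc fzero) _ = inj₂ (inj₁ refl)
triangle-adjacent (fsuc (fsuc fzero)) (fsuc (fsuc fzero)) i≢j = ⊥-elim (i≢j refl)

triangle-isOddBicycle : ∀ {A} {T : Graph A} (g : Fin 3 → A)
  → (∀ i j → g i ≡ g j → i ≡ j)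
  → (∀ a → vert T a ⇔ (∃[ i ] g i ≡ a))
  → (∀ i j → i ≢ j → edge T (g i) (g j))
  → (∀ a b → edge T a b → a ≢ b)
  → IsOddBicycle T
triangle-isOddBicycle g g-inj verts edges loopless = 0 , g , g-inj , verts , λ i j → mk⇔
  (λ e → triangle-adjacent i j (λ i≡j → loopless _ _ e (cong g i≡j)))
  (λ { (inj₁ ij) → edges i j (cycSucc-irreflexive 2≤3 i j ij)
     ; (inj₂ ji) → edges i j (λ i≡j → cycSucc-irreflexive 2≤3 j i ji (sym i≡j)) })
  where
  2≤3 : 2 ≤ 3
  2≤3 = s≤s (s≤s z≤n)

module ForestContraction {A : Set} (_≟_ : DecidableEquality A)
    (H : Graph A) (wf : WellFormed H) (x y z : A) where

  Root : A → Set
  Root a = a ≡ x ⊎ a ≡ y ⊎ a ≡ z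

  data RootPath : A → A → Set where
    root : ∀ r → Root r → RootPath r r
    step : ∀ {u w r} → ¬ Root w → edge H u w → RootPath u r → RootPath w r

  rootPath-root : ∀ {w r} → RootPath w r → Root r
  rootPath-root (root r r-root) = r-root
  rootPath-root (step _ _ t) = rootPath-root t

  InDegreeOne : Set
  InDegreeOne = ∀ w → ¬ Root w → ∀ u u' → edge H u w → edge H u' w → u ≡ u'

  rootPath-unique : InDegreeOne → ∀ {w r r'} → RootPath w r → RootPath w r' → r ≡ r'
  rootPath-unique one (root r _) (root .r _) = refl
  rootPath-unique one (root r r-root) (step w-nonroot _ _) = ⊥-elim (w-nonroot r-root)
  rootPath-unique one (step w-nonroot _ _) (root _ w-root) = ⊥-elim (w-nonroot w-root)
  rootPath-unique one {w} (step {u} w-nonroot e t) (step {u'} _ e' t')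
    with one w w-nonroot u u' e e'
  ... | refl = rootPath-unique one t t'

  rootPath-along : ∀ (h : ℕ → A) s l {r}
    → (∀ i → s ≤ i → i < s + l → edge H (h i) (h (suc i)) × ¬ Root (h (suc i)))
    → RootPath (h s) r → RootPath (h (s + l)) r
  rootPath-along h s zero {r} _ t = subst (λ i → RootPath (h i) r) (sym (+-identityʳ s)) t
  rootPath-along h s (suc l) {r} steps t =
    subst (λ i → RootPath (h i) r) (sym (+-suc s l))
      (rootPath-along h (suc s) l steps′ (step (proj₂ first) (proj₁ first) t))
    where
    first : edge H (h s) (h (suc s)) × ¬ Root (h (suc s))
    first = steps s ≤-refl (m<m+n s (s≤s z≤n))
    steps′ : ∀ i → suc s ≤ i → i < suc s + l → edge H (h i) (h (suc i)) × ¬ Root (h (suc i))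
    steps′ i s<i i<s+l = steps i (<⇒≤ s<i) (subst (i <_) (sym (+-suc s l)) i<s+l)

  -- (w , r) ∈ D records that w has been contracted into the root r.
  Merges : Set
  Merges = List (A × A)

  Merged : A → Merges → Set
  Merged a D = Any (λ m → a ≡ proj₁ m) D

  merged? : ∀ a D → Dec (Merged a D)
  merged? a D = any? (λ m → a ≟ proj₁ m) D

  rootOf : Merges → A → A
  rootOf [] v = v
  rootOf ((w , r) ∷ D) v with v ≟ w
  ... | yes _ = r
  ... | no _ = rootOf D v

  Consistent : Merges → Set
  Consistent [] = ⊤
  Consistent ((w , r) ∷ D) = RootPath w r × ¬ Root w × Consistent D

  rootOf-merged : ∀ D → Consistent D → ∀ v → Merged v D → RootPath v (rootOf D v)
  rootOf-merged ((w , r) ∷ D) (t , _ , c) v v∈D with v ≟ w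
  ... | yes refl = t
  rootOf-merged ((w , r) ∷ D) (t , _ , c) v (here v≡w) | no v≢w = ⊥-elim (v≢w v≡w)
  rootOf-merged ((w , r) ∷ D) (t , _ , c) v (there v∈D) | no _ = rootOf-merged D c v v∈D

  rootOf-unmerged : ∀ D v → ¬ Merged v D → rootOf D v ≡ v
  rootOf-unmerged [] v _ = refl
  rootOf-unmerged ((w , r) ∷ D) v v∉D with v ≟ w
  ... | yes v≡w = ⊥-elim (v∉D (here v≡w))
  ... | no _ = rootOf-unmerged D v (λ v∈D → v∉D (there v∈D))

  root-unmerged : ∀ D → Consistent D → ∀ v → Root v → ¬ Merged v D
  root-unmerged ((w , r) ∷ D) (_ , w-nonroot , _) v v-root (here refl) = w-nonroot v-root
  root-unmerged ((w , r) ∷ D) (_ , _ , c) v v-root (there v∈D) = root-unmerged D c v v-root v∈D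

  rootOf-root : ∀ D → Consistent D → ∀ v → Merged v D → Root (rootOf D v)
  rootOf-root D c v v∈D = rootPath-root (rootOf-merged D c v v∈D)

  rootOf-∷ : ∀ D → Consistent D → ∀ w r → ¬ Merged w D → ¬ Root w
           → ∀ v → rootOf ((w , r) ∷ D) v ≡ merge _≟_ r w (rootOf D v)
  rootOf-∷ D c w r w∉D w-nonroot v with v ≟ w
  ... | yes refl = trans (sym (merge-merged _≟_ r v)) (cong (merge _≟_ r v) (sym (rootOf-unmerged D v w∉D)))
  ... | no v≢w with merged? v D
  ...   | yes v∈D = sym (merge-other _≟_ r w (rootOf D v)
                      (λ eq → w-nonroot (subst Root eq (rootOf-root D c v v∈D))))
  ...   | no v∉D = trans (rootOf-unmerged D v v∉D)
                     (sym (trans (cong (merge _≟_ r w) (rootOf-unmerged D v v∉D)) (merge-other _≟_ r w v v≢w)))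

  -- Vertices of L can be merged in this order when S is already merged: each has an
  -- in-edge from a root or from an earlier vertex.
  data MergeOrder (S : A → Set) : List A → Set where
    []  : MergeOrder S []
    _∷_ : ∀ {w L} → ¬ Root w × (Σ A λ u → edge H u w × (Root u ⊎ S u))
        → MergeOrder (λ a → a ≡ w ⊎ S a) L → MergeOrder S (w ∷ L)

  mergeOrder-++ : ∀ {S : A → Set} L₁ {L₂} → MergeOrder S L₁
    → (∀ {S' : A → Set} → (∀ a → S a → S' a) → (∀ a → a ∈ L₁ → S' a) → MergeOrder S' L₂)
    → MergeOrder S (L₁ ++ L₂)
  mergeOrder-++ [] [] rest = rest (λ a s → s) (λ a ())
  mergeOrder-++ (w ∷ L₁) (h ∷ O) rest = h ∷ mergeOrder-++ L₁ O (λ S⊆S' L₁⊆S' →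
    rest (λ a s → S⊆S' a (inj₂ s))
         (λ { a (here refl) → S⊆S' a (inj₁ refl) ; a (there a∈L₁) → L₁⊆S' a a∈L₁ }))

  segment : (ℕ → A) → ℕ → ℕ → List A
  segment h s zero = []
  segment h s (suc l) = h s ∷ segment h (suc s) l

  ∈-segment : ∀ h s l i → s ≤ i → i < s + l → h i ∈ segment h s l
  ∈-segment h s zero i s≤i i<s+0 = ⊥-elim (<⇒≱ i<s+0 (subst (_≤ i) (sym (+-identityʳ s)) s≤i))
  ∈-segment h s (suc l) i s≤i i<s+l with s ≟ℕ i
  ... | yes refl = here refl
  ... | no s≢i = there (∈-segment h (suc s) l i (≤∧≢⇒< s≤i s≢i) (subst (i <_) (+-suc s l) i<s+l))

  segment-mergeOrder : ∀ {S : A → Set} h s l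
    → (∀ i → s ≤ i → i < s + l → ¬ Root (h i))
    → (0 < l → Σ A λ u → edge H u (h s) × (Root u ⊎ S u))
    → (∀ i → s ≤ i → suc i < s + l → edge H (h i) (h (suc i)))
    → MergeOrder S (segment h s l)
  segment-mergeOrder h s zero _ _ _ = []
  segment-mergeOrder h s (suc l) nonroot first steps =
    (nonroot s ≤-refl s<s+1+l , first (s≤s z≤n)) ∷
    segment-mergeOrder h (suc s) l
      (λ i s<i i<s+l → nonroot i (<⇒≤ s<i) (subst (i <_) (sym (+-suc s l)) i<s+l))
      (λ 0<l → h s , steps s ≤-refl (subst (suc s <_) (sym (+-suc s l)) (s≤s (m<m+n s 0<l))) , inj₂ (inj₁ refl))
      (λ i s<i 1+i<s+l → steps i (<⇒≤ s<i) (subst (suc i <_) (sym (+-suc s l)) 1+i<s+l))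
    where
    s<s+1+l : s < s + suc l
    s<s+1+l = m<m+n s (s≤s z≤n)

  mergeStep : InDegreeOne → ∀ {K D w u} → K ≃ᴳ quotient H (rootOf D) → Consistent D
    → ¬ Merged w D → ¬ Root w → edge H u w → RootPath u (rootOf D u)
    → ButterflyContractible K (rootOf D u) w
      × contract _≟_ K (rootOf D u) w ≃ᴳ quotient H (rootOf ((w , rootOf D u) ∷ D))
  mergeStep one {K} {D} {w} {u} K≃ c w∉D w-nonroot uw tu =
    contractible-resp-≃ᴳ K≃ ((r≢w , u , w , uw , refl , rootOf-unmerged D w w∉D) , inj₂ onlyIn) ,
    ≃ᴳ-trans (contract-resp-≃ᴳ _≟_ r w K≃)
      (≃ᴳ-trans (contract-quotient _≟_ H (rootOf D) r w r-fixed r≢w)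
        (quotient-cong H (λ v → sym (rootOf-∷ D c w r w∉D w-nonroot v))))
    where
    r : A
    r = rootOf D u
    r≢w : r ≢ w
    r≢w r≡w = w-nonroot (subst Root r≡w (rootPath-root tu))
    r-fixed : rootOf D r ≡ r
    r-fixed = rootOf-unmerged D r (root-unmerged D c r (rootPath-root tu))
    onlyIn : ∀ a → edge (quotient H (rootOf D)) a w → a ≡ r
    onlyIn a (_ , x' , y' , e' , σx'≡a , σy'≡w) with merged? y' D
    ... | yes y'∈D = ⊥-elim (w-nonroot (subst Root σy'≡w (rootOf-root D c y' y'∈D)))
    ... | no y'∉D with trans (sym (rootOf-unmerged D y' y'∉D)) σy'≡w
    ...   | refl = trans (sym σx'≡a) (cong (rootOf D) (one w w-nonroot x' u e' uw))

  record ContractionOf (K : Graph A) (D : Merges) (L : List A) : Set₁ where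
    field
      result     : Graph A
      merges     : Merges
      contracts  : Contracts _≟_ K result
      result≃    : result ≃ᴳ quotient H (rootOf merges)
      consistent : Consistent merges
      keeps      : ∀ a → Merged a D → Merged a merges
      covers     : ∀ a → a ∈ L → Merged a merges
  open ContractionOf

  contractAlong : InDegreeOne → ∀ L D K → K ≃ᴳ quotient H (rootOf D) → Consistent D
    → ∀ {S} → (∀ a → S a → Merged a D) → MergeOrder S L → ContractionOf K D L
  contractAlong one [] D K K≃ c _ [] = record
    { result = K ; merges = D ; contracts = done K ; result≃ = K≃ ; consistent = c
    ; keeps = λ a a∈D → a∈D ; covers = λ a () }
  contractAlong one (w ∷ L) D K K≃ c {S} S⊆D ((w-nonroot , u , uw , u-ok) ∷ O) with merged? w D
  ... | yes w∈D = record
    { result = result o ; merges = merges o ; contracts = contracts o ; result≃ = result≃ o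
    ; consistent = consistent o ; keeps = keeps o
    ; covers = λ { a (here refl) → keeps o a w∈D ; a (there a∈L) → covers o a a∈L } }
    where
    o : ContractionOf K D L
    o = contractAlong one L D K K≃ c (λ { a (inj₁ refl) → w∈D ; a (inj₂ s) → S⊆D a s }) O
  ... | no w∉D = record
    { result = result o ; merges = merges o ; result≃ = result≃ o ; consistent = consistent o
    ; contracts = step K (result o) r w r≢w (proj₁ merged) (contracts o)
    ; keeps = λ a a∈D → keeps o a (there a∈D)
    ; covers = λ { a (here refl) → keeps o a (here refl) ; a (there a∈L) → covers o a a∈L } }
    where
    r : A
    r = rootOf D u
    pathFrom : Root u ⊎ S u → RootPath u r
    pathFrom (inj₁ u-root) = subst (RootPath u) (sym (rootOf-unmerged D u (root-unmerged D c u u-root))) (root u u-root)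
    pathFrom (inj₂ s) = rootOf-merged D c u (S⊆D u s)
    tu : RootPath u r
    tu = pathFrom u-ok
    r≢w : r ≢ w
    r≢w r≡w = w-nonroot (subst Root r≡w (rootPath-root tu))
    merged : ButterflyContractible K r w × contract _≟_ K r w ≃ᴳ quotient H (rootOf ((w , r) ∷ D))
    merged = mergeStep one K≃ c w∉D w-nonroot uw tu
    o : ContractionOf (contract _≟_ K r w) ((w , r) ∷ D) L
    o = contractAlong one L ((w , r) ∷ D) (contract _≟_ K r w) (proj₂ merged)
          (step w-nonroot uw tu , w-nonroot , c)
          (λ { a (inj₁ refl) → here refl ; a (inj₂ s) → there (S⊆D a s) }) O

  Adjacent : A → A → Set
  Adjacent r r' = Σ A λ a → edge H a r' × RootPath a r

  corner : Fin 3 → A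
  corner fzero = x
  corner (fsuc fzero) = y
  corner (fsuc (fsuc fzero)) = z

  corner-root : ∀ i → Root (corner i)
  corner-root fzero = inj₁ refl
  corner-root (fsuc fzero) = inj₂ (inj₁ refl)
  corner-root (fsuc (fsuc fzero)) = inj₂ (inj₂ refl)

  root-corner : ∀ a → Root a → ∃[ i ] corner i ≡ a
  root-corner a (inj₁ refl) = fzero , refl
  root-corner a (inj₂ (inj₁ refl)) = fsuc fzero , refl
  root-corner a (inj₂ (inj₂ refl)) = fsuc (fsuc fzero) , refl

  module _ (one : InDegreeOne) (D : Merges) (c : Consistent D)
           (covered : ∀ a → vert H a → Root a ⊎ Merged a D)
           (x∈H : vert H x) (y∈H : vert H y) (z∈H : vert H z)
           (x≢y : x ≢ y) (y≢z : y ≢ z) (x≢z : x ≢ z)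
           (xy : Adjacent x y) (xz : Adjacent x z) (yx : Adjacent y x)
           (yz : Adjacent y z) (zx : Adjacent z x) (zy : Adjacent z y) where

    corner-injective : ∀ i j → corner i ≡ corner j → i ≡ j
    corner-injective fzero fzero _ = refl
    corner-injective fzero (fsuc fzero) eq = ⊥-elim (x≢y eq)
    corner-injective fzero (fsuc (fsuc fzero)) eq = ⊥-elim (x≢z eq)
    corner-injective (fsuc fzero) fzero eq = ⊥-elim (x≢y (sym eq))
    corner-injective (fsuc fzero) (fsuc fzero) _ = refl
    corner-injective (fsuc fzero) (fsuc (fsuc fzero)) eq = ⊥-elim (y≢z eq)
    corner-injective (fsuc (fsuc fzero)) fzero eq = ⊥-elim (x≢z (sym eq))
    corner-injective (fsuc (fsuc fzero)) (fsuc fzero) eq = ⊥-elim (y≢z (sym eq))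
    corner-injective (fsuc (fsuc fzero)) (fsuc (fsuc fzero)) _ = refl

    corner-adjacent : ∀ i j → i ≢ j → Adjacent (corner i) (corner j)
    corner-adjacent fzero fzero i≢j = ⊥-elim (i≢j refl)
    corner-adjacent fzero (fsuc fzero) _ = xy
    corner-adjacent fzero (fsuc (fsuc fzero)) _ = xz
    corner-adjacent (fsuc fzero) fzero _ = yx
    corner-adjacent (fsuc fzero) (fsuc fzero) i≢j = ⊥-elim (i≢j refl)
    corner-adjacent (fsuc fzero) (fsuc (fsuc fzero)) _ = yz
    corner-adjacent (fsuc (fsuc fzero)) fzero _ = zx
    corner-adjacent (fsuc (fsuc fzero)) (fsuc fzero) _ = zy
    corner-adjacent (fsuc (fsuc fzero)) (fsuc (fsuc fzero)) i≢j = ⊥-elim (i≢j refl)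

    corner-vert : ∀ i → vert H (corner i)
    corner-vert fzero = x∈H
    corner-vert (fsuc fzero) = y∈H
    corner-vert (fsuc (fsuc fzero)) = z∈H

    corner-fixed : ∀ i → rootOf D (corner i) ≡ corner i
    corner-fixed i = rootOf-unmerged D (corner i) (root-unmerged D c (corner i) (corner-root i))

    rootOf-rootPath : ∀ a r → vert H a → RootPath a r → rootOf D a ≡ r
    rootOf-rootPath a r a∈H t with covered a a∈H
    ... | inj₁ a-root = trans (rootOf-unmerged D a (root-unmerged D c a a-root)) (rootPath-unique one (root a a-root) t)
    ... | inj₂ a∈D = rootPath-unique one (rootOf-merged D c a a∈D) t

    quotient-vert : ∀ a → vert (quotient H (rootOf D)) a ⇔ (∃[ i ] corner i ≡ a)
    quotient-vert a = mk⇔ to (λ { (i , refl) → corner-vert i , corner-fixed i })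
      where
      to : vert (quotient H (rootOf D)) a → ∃[ i ] corner i ≡ a
      to (a∈H , fixed) with covered a a∈H
      ... | inj₁ a-root = root-corner a a-root
      ... | inj₂ a∈D = root-corner a (subst Root fixed (rootOf-root D c a a∈D))

    quotient-edge : ∀ i j → i ≢ j → edge (quotient H (rootOf D)) (corner i) (corner j)
    quotient-edge i j i≢j with corner-adjacent i j i≢j
    ... | a , e , t = (λ eq → i≢j (corner-injective i j eq)) , a , corner j , e ,
                      rootOf-rootPath a (corner i) (proj₁ (wf a (corner j) e)) t , corner-fixed j

    quotient-isOddBicycle : IsOddBicycle (quotient H (rootOf D))
    quotient-isOddBicycle = triangle-isOddBicycle corner corner-injective quotient-vert quotient-edge loopless
      where
      loopless : ∀ a b → edge (quotient H (rootOf D)) a b → a ≢ b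
      loopless _ _ = proj₁

module _ (n : ℕ) .{{_ : NonZero n}} where

  toℕ-mod : ∀ x → toℕ (x mod n) ≡ x % n
  toℕ-mod x = toℕ-fromℕ< (m%n<n x n)

  [m%n+o]%n≡[m+o]%n : ∀ m o → (m % n + o) % n ≡ (m + o) % n
  [m%n+o]%n≡[m+o]%n m o = trans (%-distribˡ-+ (m % n) o n)
    (trans (cong (λ t → (t + o % n) % n) (m%n%n≡m%n m n)) (sym (%-distribˡ-+ m o n)))

  [1+m]%n≡[1+m%n]%n : ∀ m → suc m % n ≡ suc (m % n) % n
  [1+m]%n≡[1+m%n]%n m = begin
    suc m % n         ≡⟨ cong (_% n) (+-comm 1 m) ⟩
    (m + 1) % n       ≡⟨ sym ([m%n+o]%n≡[m+o]%n m 1) ⟩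
    (m % n + 1) % n   ≡⟨ cong (_% n) (+-comm (m % n) 1) ⟩
    suc (m % n) % n   ∎
    where open ≡-Reasoning

  mod-cycSucc : ∀ m → CycSucc n (m mod n) (suc m mod n)
  mod-cycSucc m with m≤n⇒m<n∨m≡n (m%n<n m n)
  ... | inj₁ 1+m%n<n = inj₁ (begin
    suc (toℕ (m mod n))  ≡⟨ cong suc (toℕ-mod m) ⟩
    suc (m % n)          ≡⟨ sym (m<n⇒m%n≡m 1+m%n<n) ⟩
    suc (m % n) % n      ≡⟨ sym ([1+m]%n≡[1+m%n]%n m) ⟩
    suc m % n            ≡⟨ sym (toℕ-mod (suc m)) ⟩
    toℕ (suc m mod n)    ∎)
    where open ≡-Reasoning
  ... | inj₂ 1+m%n≡n = inj₂ (trans (cong suc (toℕ-mod m)) 1+m%n≡n ,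
    trans (toℕ-mod (suc m)) (trans ([1+m]%n≡[1+m%n]%n m) (trans (cong (_% n) 1+m%n≡n) (n%n≡0 n))))

  [[B+c]%n+[n∸B%n]]%n≡c : ∀ B c → c < n → ((B + c) % n + (n ∸ B % n)) % n ≡ c
  [[B+c]%n+[n∸B%n]]%n≡c B c c<n = begin
    ((B + c) % n + b′) % n       ≡⟨ cong (λ t → (t + b′) % n) (sym ([m%n+o]%n≡[m+o]%n B c)) ⟩
    ((b + c) % n + b′) % n       ≡⟨ [m%n+o]%n≡[m+o]%n (b + c) b′ ⟩
    (b + c + b′) % n             ≡⟨ cong (_% n) (trans (cong (_+ b′) (+-comm b c)) (+-assoc c b b′)) ⟩
    (c + (b + b′)) % n           ≡⟨ cong (λ t → (c + t) % n) (m+[n∸m]≡n (m%n≤n B n)) ⟩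
    (c + n) % n                  ≡⟨ [m+n]%n≡m%n c n ⟩
    c % n                        ≡⟨ m<n⇒m%n≡m c<n ⟩
    c                            ∎
    where
    open ≡-Reasoning
    b b′ : ℕ
    b = B % n
    b′ = n ∸ B % n

  +-mod-injective : ∀ B {c c'} → c < n → c' < n → (B + c) mod n ≡ (B + c') mod n → c ≡ c'
  +-mod-injective B {c} {c'} c<n c'<n eq = begin
    c                                          ≡⟨ sym ([[B+c]%n+[n∸B%n]]%n≡c B c c<n) ⟩
    ((B + c) % n + (n ∸ B % n)) % n            ≡⟨ cong (λ t → (t + (n ∸ B % n)) % n) same ⟩
    ((B + c') % n + (n ∸ B % n)) % n           ≡⟨ [[B+c]%n+[n∸B%n]]%n≡c B c' c'<n ⟩
    c'                                         ∎
    where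
    open ≡-Reasoning
    same : (B + c) % n ≡ (B + c') % n
    same = trans (sym (toℕ-mod (B + c))) (trans (cong toℕ eq) (toℕ-mod (B + c')))

  [[a+[n∸d]]%n+d]%n≡a : ∀ a d → d ≤ n → a < n → ((a + (n ∸ d)) % n + d) % n ≡ a
  [[a+[n∸d]]%n+d]%n≡a a d d≤n a<n = begin
    ((a + (n ∸ d)) % n + d) % n   ≡⟨ [m%n+o]%n≡[m+o]%n (a + (n ∸ d)) d ⟩
    (a + (n ∸ d) + d) % n         ≡⟨ cong (_% n) (trans (+-assoc a (n ∸ d) d) (cong (a +_) (m∸n+n≡m d≤n))) ⟩
    (a + n) % n                   ≡⟨ [m+n]%n≡m%n a n ⟩
    a % n                         ≡⟨ m<n⇒m%n≡m a<n ⟩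
    a                             ∎
    where open ≡-Reasoning

%2-cancelʳ : ∀ {s e t} → s < 2 → e < 2 → (s + e) % 2 ≡ t → s ≡ (t + e) % 2
%2-cancelʳ {0} {0} _ _ refl = refl
%2-cancelʳ {0} {1} _ _ refl = refl
%2-cancelʳ {1} {0} _ _ refl = refl
%2-cancelʳ {1} {1} _ _ refl = refl
%2-cancelʳ {suc (suc _)} (s≤s (s≤s ())) _ _
%2-cancelʳ {_} {suc (suc _)} _ (s≤s (s≤s ())) _

∈1,2⇒≤2 : ∀ {d} → d ≡ 1 ⊎ d ≡ 2 → d ≤ 2
∈1,2⇒≤2 (inj₁ refl) = s≤s z≤n
∈1,2⇒≤2 (inj₂ refl) = ≤-refl

-- The cylindrical grid of order k = j + 3, seen from C₁ or from C_k and with shifted columns.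
module GridFrame (j : ℕ) where

  k : ℕ
  k = suc (suc (suc j))

  lastRow : ℕ
  lastRow = suc (suc j)

  lastCol : ℕ
  lastCol = suc (suc (suc (suc (suc (j + j)))))

  1+lastCol≡k+k : suc lastCol ≡ k + k
  1+lastCol≡k+k = cong (λ t → suc (suc (suc t))) (sym (begin
    j + suc (suc (suc j))   ≡⟨ +-suc j (suc (suc j)) ⟩
    suc (j + suc (suc j))   ≡⟨ cong suc (+-suc j (suc j)) ⟩
    suc (suc (j + suc j))   ≡⟨ cong (λ t → suc (suc t)) (+-suc j j) ⟩
    suc (suc (suc (j + j))) ∎))
    where open ≡-Reasoning

  lastCol-odd : lastCol % 2 ≡ 1
  lastCol-odd = trans (cong (λ t → (5 + t) % 2) (trans (cong (j +_) (sym (+-identityʳ j))) (*-comm 2 j)))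
                      ([m+kn]%n≡m%n 5 j 2)

  2∣k+k : 2 ∣ k + k
  2∣k+k = divides k (trans (cong (k +_) (sym (+-identityʳ k))) (*-comm 2 k))

  ≤lastCol⇒<k+k : ∀ {c} → c ≤ lastCol → c < k + k
  ≤lastCol⇒<k+k {c} c≤ = subst (c <_) 1+lastCol≡k+k (s≤s c≤)

  column : ℕ → ℕ → Fin (k + k)
  column B c = (B + c) mod (k + k)

  column-parity : ∀ B c → toℕ (column B c) % 2 ≡ (B % 2 + c % 2) % 2
  column-parity B c = trans (cong (_% 2) (toℕ-mod (k + k) (B + c)))
    (trans (m∣n⇒o%n%m≡o%m 2 (k + k) (B + c) 2∣k+k) (%-distribˡ-+ B c 2))

  column-right : ∀ B c → CycSucc (k + k) (column B c) (column B (suc c))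
  column-right B c = subst (λ t → CycSucc (k + k) (column B c) (t mod (k + k)))
                       (sym (+-suc B c)) (mod-cycSucc (k + k) (B + c))

  column-wrap : ∀ B → CycSucc (k + k) (column B lastCol) (column B 0)
  column-wrap B = subst (CycSucc (k + k) (column B lastCol)) wraps (mod-cycSucc (k + k) (B + lastCol))
    where
    wraps : suc (B + lastCol) mod (k + k) ≡ column B 0
    wraps = toℕ-injective (begin
      toℕ (suc (B + lastCol) mod (k + k))  ≡⟨ toℕ-mod (k + k) (suc (B + lastCol)) ⟩
      suc (B + lastCol) % (k + k)          ≡⟨ cong (_% (k + k)) (sym (+-suc B lastCol)) ⟩
      (B + suc lastCol) % (k + k)          ≡⟨ cong (λ t → (B + t) % (k + k)) 1+lastCol≡k+k ⟩
      (B + (k + k)) % (k + k)              ≡⟨ [m+n]%n≡m%n B (k + k) ⟩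
      B % (k + k)                          ≡⟨ cong (_% (k + k)) (sym (+-identityʳ B)) ⟩
      (B + 0) % (k + k)                    ≡⟨ sym (toℕ-mod (k + k) (B + 0)) ⟩
      toℕ (column B 0)                     ∎)
      where open ≡-Reasoning

  column-injective : ∀ B {c c'} → c ≤ lastCol → c' ≤ lastCol → column B c ≡ column B c' → c ≡ c'
  column-injective B c≤ c'≤ = +-mod-injective (k + k) B (≤lastCol⇒<k+k c≤) (≤lastCol⇒<k+k c'≤)

  record Frame : Set where
    field
      cell           : ℕ → ℕ → GridV k
      cell-injective : ∀ {r c r' c'} → r ≤ lastRow → c ≤ lastCol → r' ≤ lastRow → c' ≤ lastCol
                     → cell r c ≡ cell r' c' → r ≡ r' × c ≡ c'
      cell-right     : ∀ r c → GridE k (cell r c) (cell r (suc c))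
      cell-wrap      : ∀ r → GridE k (cell r lastCol) (cell r 0)
      cell-down      : ∀ {r c} → r < lastRow → c % 2 ≡ 0 → GridE k (cell r c) (cell (suc r) c)
      cell-up        : ∀ {r c} → r < lastRow → c % 2 ≡ 1 → GridE k (cell (suc r) c) (cell r c)

  shiftedFrame : (row : ℕ → Fin k) (B : ℕ)
    → (∀ {r r'} → r ≤ lastRow → r' ≤ lastRow → row r ≡ row r' → r ≡ r')
    → (∀ {r c} → r < lastRow → c % 2 ≡ 0 → GridE k (row r , column B c) (row (suc r) , column B c))
    → (∀ {r c} → r < lastRow → c % 2 ≡ 1 → GridE k (row (suc r) , column B c) (row r , column B c))
    → Frame
  shiftedFrame row B row-injective down up = record
    { cell = λ r c → row r , column B c
    ; cell-injective = λ r≤ c≤ r'≤ c'≤ eq →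
        row-injective r≤ r'≤ (cong proj₁ eq) , column-injective B c≤ c'≤ (cong proj₂ eq)
    ; cell-right = λ r c → inj₁ (refl , column-right B c)
    ; cell-wrap = λ r → inj₁ (refl , column-wrap B)
    ; cell-down = down
    ; cell-up = up }

  toℕ-row : ∀ r → r ≤ lastRow → toℕ (r mod k) ≡ r
  toℕ-row r r≤ = trans (toℕ-mod k r) (m<n⇒m%n≡m (s≤s r≤))

  mod-row : ∀ r (i : Fin k) → r ≤ lastRow → r ≡ toℕ i → r mod k ≡ i
  mod-row r i r≤ r≡i = toℕ-injective (trans (toℕ-row r r≤) r≡i)

  parity-shift : ∀ B c {b e} → B % 2 ≡ b → c % 2 ≡ e → toℕ (column B c) % 2 ≡ (b + e) % 2
  parity-shift B c B≡b c≡e = trans (column-parity B c) (cong₂ (λ s t → (s + t) % 2) B≡b c≡e)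

  downwardFrame : (B : ℕ) → B % 2 ≡ 0 → Frame
  downwardFrame B B-even = shiftedFrame (_mod k) B
    (λ {r} {r'} r≤ r'≤ eq → trans (sym (toℕ-row r r≤)) (trans (cong toℕ eq) (toℕ-row r' r'≤)))
    (λ {c = c} r< c-even → inj₂ (inj₁ (refl , parity-shift B c B-even c-even , rowStep r<)))
    (λ {c = c} r< c-odd → inj₂ (inj₂ (refl , parity-shift B c B-even c-odd , rowStep r<)))
    where
    rowStep : ∀ {r} → r < lastRow → suc (toℕ (r mod k)) ≡ toℕ (suc r mod k)
    rowStep {r} r< = trans (cong suc (toℕ-row r (<⇒≤ r<))) (sym (toℕ-row (suc r) r<))

  upwardFrame : (B : ℕ) → B % 2 ≡ 1 → Frame
  upwardFrame B B-odd = shiftedFrame (λ r → (lastRow ∸ r) mod k) B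
    (λ {r} {r'} r≤ r'≤ eq → ∸-cancelˡ-≡ r≤ r'≤
      (trans (sym (toℕ-row (lastRow ∸ r) (m∸n≤m lastRow r)))
        (trans (cong toℕ eq) (toℕ-row (lastRow ∸ r') (m∸n≤m lastRow r')))))
    (λ {c = c} r< c-even → inj₂ (inj₂ (refl , parity-shift B c B-odd c-even , rowStep r<)))
    (λ {c = c} r< c-odd → inj₂ (inj₁ (refl , parity-shift B c B-odd c-odd , rowStep r<)))
    where
    rowStep : ∀ {r} → r < lastRow → suc (toℕ ((lastRow ∸ suc r) mod k)) ≡ toℕ ((lastRow ∸ r) mod k)
    rowStep {r} r< = trans (cong suc (toℕ-row (lastRow ∸ suc r) (m∸n≤m lastRow (suc r))))
      (trans (sym (+-∸-assoc 1 r<)) (sym (toℕ-row (lastRow ∸ r) (m∸n≤m lastRow r))))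

  record AlignedFrame {N : ℕ} {ED : Fin N → Fin N → Set} (G : GridIn N ED k) (P : PerimeterJump G) : Set where
    field
      frame    : Frame
      d bp     : ℕ
      d∈1,2    : d ≡ 1 ⊎ d ≡ 2
      bp≤      : bp ≤ lastCol
      starts   : φ G (Frame.cell frame 0 d) ≡ p P fzero
      ends     : φ G (Frame.cell frame lastRow bp) ≡ p P (fromℕ (suc (m P)))

  -- Of the two shifts that put column t into frame column 1 or 2, one has parity b.
  startOffset : ∀ t b → b < 2 → Σ ℕ λ d → (d ≡ 1 ⊎ d ≡ 2) × (t % 2 + d % 2) % 2 ≡ b
  startOffset t b b<2 with t % 2 | m%n<n t 2
  startOffset t 0 _ | 0 | _ = 2 , inj₂ refl , refl
  startOffset t 1 _ | 0 | _ = 1 , inj₁ refl , refl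
  startOffset t 0 _ | 1 | _ = 1 , inj₁ refl , refl
  startOffset t 1 _ | 1 | _ = 2 , inj₂ refl , refl
  startOffset t (suc (suc _)) (s≤s (s≤s ())) | _ | _
  startOffset t _ _ | suc (suc _) | s≤s (s≤s ())

  align : ∀ {N ED} {G : GridIn N ED k} {P : PerimeterJump G} b → b < 2 → (row : ℕ → Fin k)
    → (frameFor : ∀ B → B % 2 ≡ b → Frame)
    → (∀ B B-par r c → Frame.cell (frameFor B B-par) r c ≡ (row r , column B c))
    → ∀ {ia ja ib jb} → row 0 ≡ ia → row lastRow ≡ ib
    → φ G (ia , ja) ≡ p P fzero → φ G (ib , jb) ≡ p P (fromℕ (suc (m P)))
    → AlignedFrame G P
  align {G = G} {P} b b<2 row frameFor cell≡ {ja = ja} {jb = jb} row0≡ia rowLast≡ib start end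
    with startOffset (toℕ ja) b b<2
  ... | d , d∈1,2 , d-parity = record
    { frame = frameFor B B-parity ; d = d ; bp = bp ; d∈1,2 = d∈1,2
    ; bp≤ = ≤-pred (subst (bp <_) (sym 1+lastCol≡k+k) (m%n<n (toℕ jb + (k + k ∸ B)) (k + k)))
    ; starts = trans (cong (φ G) (trans (cell≡ B B-parity 0 d) (cong₂ _,_ row0≡ia hits-start))) start
    ; ends = trans (cong (φ G) (trans (cell≡ B B-parity lastRow bp) (cong₂ _,_ rowLast≡ib hits-end))) end }
    where
    d≤k+k : d ≤ k + k
    d≤k+k = ≤-trans (∈1,2⇒≤2 d∈1,2) (s≤s (s≤s z≤n))
    B : ℕ
    B = (toℕ ja + (k + k ∸ d)) % (k + k)
    hits-start : column B d ≡ ja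
    hits-start = toℕ-injective (trans (toℕ-mod (k + k) (B + d))
      ([[a+[n∸d]]%n+d]%n≡a (k + k) (toℕ ja) d d≤k+k (toℕ<n ja)))
    B-parity : B % 2 ≡ b
    B-parity = trans (%2-cancelʳ (m%n<n B 2) (m%n<n d 2)
      (trans (sym (column-parity B d)) (cong (λ t → toℕ t % 2) hits-start))) d-parity
    bp : ℕ
    bp = (toℕ jb + (k + k ∸ B)) % (k + k)
    hits-end : column B bp ≡ jb
    hits-end = toℕ-injective (trans (toℕ-mod (k + k) (B + bp)) (trans (cong (_% (k + k)) (+-comm B bp))
      ([[a+[n∸d]]%n+d]%n≡a (k + k) (toℕ jb) B (<⇒≤ (m%n<n (toℕ ja + (k + k ∸ d)) (k + k))) (toℕ<n jb))))

  jumpAligned : ∀ {N ED} (G : GridIn N ED k) (P : PerimeterJump G) → AlignedFrame G P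
  jumpAligned G P with p-ends P
  ... | inj₁ ((ia , _) , (ib , _) , ia≡0 , 1+ib≡k , start , end) =
    align 0 (s≤s z≤n) (_mod k) downwardFrame (λ _ _ _ _ → refl)
      (mod-row 0 ia z≤n (sym ia≡0)) (mod-row lastRow ib ≤-refl (sym (suc-injective 1+ib≡k))) start end
  ... | inj₂ ((ia , _) , (ib , _) , 1+ia≡k , ib≡0 , start , end) =
    align 1 ≤-refl (λ r → (lastRow ∸ r) mod k) upwardFrame (λ _ _ _ _ → refl)
      (mod-row lastRow ia ≤-refl (sym (suc-injective 1+ia≡k)))
      (trans (cong (_mod k) (n∸n≡0 lastRow)) (mod-row 0 ib z≤n (sym ib≡0))) start end

module Pattern (j : ℕ) {N : ℕ} {ED : Fin N → Fin N → Set} {G : GridIn N ED (GridFrame.k j)}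
    {P : PerimeterJump G} (aligned : GridFrame.AlignedFrame j G P) where

  open GridFrame j
  open AlignedFrame aligned
  open Frame frame

  len : ℕ
  len = m P

  data Node : Set where
    grid  : ℕ → ℕ → Node
    inner : ℕ → Node

  -- Three branches, in frame coordinates (row, column):
  --   x = (0, lastCol) feeds (0,0);
  --   y = (0,1) feeds (0,2) if d = 2, then the jump, the last row from bp on, and
  --     column lastCol upwards to row 1;
  --   z = (1,0) feeds (1,1), (1,2), (1,3), then (0,3), …, (0, lastCol ∸ 1).
  -- The six links into x, y and z are the ones joining different branches.
  data Link : Node → Node → Set where
    right-00    : Link (grid 0 0) (grid 0 1)
    right-01    : d ≡ 2 → Link (grid 0 1) (grid 0 2)
    jump-first  : 1 ≤ len → Link (grid 0 d) (inner 1)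
    jump-inner  : ∀ i → 1 ≤ i → suc i ≤ len → Link (inner i) (inner (suc i))
    jump-last   : ∀ c → 1 ≤ len → c ≡ bp → Link (inner len) (grid lastRow c)
    jump-direct : ∀ c → len ≡ 0 → c ≡ bp → Link (grid 0 d) (grid lastRow c)
    right-last  : ∀ c c' → bp ≤ c → c < lastCol → c' ≡ suc c → Link (grid lastRow c) (grid lastRow c')
    up-lastCol  : ∀ r r' → r < lastRow → r' ≡ suc r → Link (grid r' lastCol) (grid r lastCol)
    right-1     : ∀ c → c < 3 → Link (grid 1 c) (grid 1 (suc c))
    up-3        : Link (grid 1 3) (grid 0 3)
    right-0     : ∀ c → 3 ≤ c → c < lastCol → Link (grid 0 c) (grid 0 (suc c))
    wrap-0      : Link (grid 0 lastCol) (grid 0 0)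
    down-0      : Link (grid 0 0) (grid 1 0)
    wrap-1      : Link (grid 1 lastCol) (grid 1 0)
    up-1        : Link (grid 1 1) (grid 0 1)

  embed : Node → Fin N
  embed (grid r c) = φ G (cell r c)
  embed (inner i) = p P (i mod suc (suc len))

  InRange : Node → Set
  InRange (grid r c) = r ≤ lastRow × c ≤ lastCol
  InRange (inner i) = 1 ≤ i × i ≤ len

  toℕ-inner : ∀ i → i ≤ suc len → toℕ (i mod suc (suc len)) ≡ i
  toℕ-inner i i≤ = trans (toℕ-mod (suc (suc len)) i) (m<n⇒m%n≡m (s≤s i≤))

  inner-internal : ∀ i → 1 ≤ i → i ≤ len → Σ (Fin len) λ i' → i mod suc (suc len) ≡ fsuc (inject₁ i')
  inner-internal (suc i) _ i≤ = fromℕ< i≤ , toℕ-injective (trans (toℕ-inner (suc i) (≤-trans i≤ (n≤1+n len)))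
    (cong suc (sym (trans (toℕ-inject₁ (fromℕ< i≤)) (toℕ-fromℕ< i≤)))))

  embed-injective : ∀ w w' → InRange w → InRange w' → embed w ≡ embed w' → w ≡ w'
  embed-injective (grid r c) (grid r' c') (r≤ , c≤) (r'≤ , c'≤) eq
    with cell-injective r≤ c≤ r'≤ c'≤ (φ-inj G _ _ eq)
  ... | refl , refl = refl
  embed-injective (grid r c) (inner i) _ (1≤i , i≤) eq with inner-internal i 1≤i i≤
  ... | i' , internal = ⊥-elim (p-int P i' (cell r c) (trans (cong (p P) (sym internal)) (sym eq)))
  embed-injective (inner i) (grid r c) (1≤i , i≤) _ eq with inner-internal i 1≤i i≤
  ... | i' , internal = ⊥-elim (p-int P i' (cell r c) (trans (cong (p P) (sym internal)) eq))
  embed-injective (inner i) (inner i') (_ , i≤) (_ , i'≤) eq = cong inner (begin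
    i                                ≡⟨ sym (toℕ-inner i (≤-trans i≤ (n≤1+n len))) ⟩
    toℕ (i mod suc (suc len))        ≡⟨ cong toℕ (p-inj P _ _ eq) ⟩
    toℕ (i' mod suc (suc len))       ≡⟨ toℕ-inner i' (≤-trans i'≤ (n≤1+n len)) ⟩
    i'                               ∎)
    where open ≡-Reasoning

  small : ∀ {c} → c ≤ 5 → c ≤ lastCol
  small c≤5 = ≤-trans c≤5 (m≤m+n 5 (j + j))

  1≤lastRow : 1 ≤ lastRow
  1≤lastRow = s≤s z≤n

  d≤2 : d ≤ 2
  d≤2 = ∈1,2⇒≤2 d∈1,2

  link-inRange : ∀ {a b} → Link a b → InRange a × InRange b
  link-inRange right-00 = (z≤n , z≤n) , (z≤n , small (s≤s z≤n))
  link-inRange (right-01 _) = (z≤n , small (s≤s z≤n)) , (z≤n , small (s≤s (s≤s z≤n)))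
  link-inRange (jump-first 1≤len) = (z≤n , small (≤-trans d≤2 (m≤m+n 2 3))) , (≤-refl , 1≤len)
  link-inRange (jump-inner i 1≤i i<len) = (1≤i , ≤-trans (n≤1+n i) i<len) , (s≤s z≤n , i<len)
  link-inRange (jump-last c 1≤len refl) = (1≤len , ≤-refl) , (≤-refl , bp≤)
  link-inRange (jump-direct c _ refl) = (z≤n , small (≤-trans d≤2 (m≤m+n 2 3))) , (≤-refl , bp≤)
  link-inRange (right-last c _ _ c< refl) = (≤-refl , <⇒≤ c<) , (≤-refl , c<)
  link-inRange (up-lastCol r _ r< refl) = (r< , ≤-refl) , (<⇒≤ r< , ≤-refl)
  link-inRange (right-1 c c<3) =
    (1≤lastRow , small (≤-trans (<⇒≤ c<3) (m≤m+n 3 2))) , (1≤lastRow , small (≤-trans c<3 (m≤m+n 3 2)))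
  link-inRange up-3 = (1≤lastRow , small (m≤m+n 3 2)) , (z≤n , small (m≤m+n 3 2))
  link-inRange (right-0 c _ c<) = (z≤n , <⇒≤ c<) , (z≤n , c<)
  link-inRange wrap-0 = (z≤n , ≤-refl) , (z≤n , z≤n)
  link-inRange down-0 = (z≤n , z≤n) , (1≤lastRow , z≤n)
  link-inRange wrap-1 = (1≤lastRow , ≤-refl) , (1≤lastRow , z≤n)
  link-inRange up-1 = (1≤lastRow , small (s≤s z≤n)) , (z≤n , small (s≤s z≤n))

  link-irreflexive : ∀ {a b} → Link a b → a ≢ b
  link-irreflexive (jump-inner i _ _) ()
  link-irreflexive (right-last _ _ _ _ refl) ()
  link-irreflexive (up-lastCol _ _ _ refl) ()
  link-irreflexive (right-1 _ _) ()
  link-irreflexive (right-0 _ _ _) ()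
  link-irreflexive right-00 ()
  link-irreflexive (right-01 _) ()
  link-irreflexive (jump-first _) ()
  link-irreflexive (jump-last _ _ _) ()
  link-irreflexive (jump-direct _ _ _) ()
  link-irreflexive up-3 ()
  link-irreflexive wrap-0 ()
  link-irreflexive down-0 ()
  link-irreflexive wrap-1 ()
  link-irreflexive up-1 ()

  skeleton : Graph (Fin N)
  skeleton = record
    { vert = λ v → Σ Node λ w → (Σ Node λ w' → Link w w' ⊎ Link w' w) × embed w ≡ v
    ; edge = λ u v → Σ Node λ a → Σ Node λ b → Link a b × embed a ≡ u × embed b ≡ v }

  skeleton-wellFormed : WellFormed skeleton
  skeleton-wellFormed u v (a , b , l , refl , refl) =
    (a , (b , inj₁ l) , refl) , (b , (a , inj₂ l) , refl) ,
    λ eq → link-irreflexive l (embed-injective a b (proj₁ (link-inRange l)) (proj₂ (link-inRange l)) eq)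

  gridEdge : ∀ {a b} → GridE k a b → edge (GridUnionJump G P) (φ G a) (φ G b)
  gridEdge {a} {b} e = inj₁ (a , b , e , refl , refl)

  jump-edge : ∀ i → i < suc len → edge (GridUnionJump G P) (embed (inner i)) (embed (inner (suc i)))
  jump-edge i i< = inj₂ (fromℕ< i< ,
    cong (p P) (toℕ-injective (trans (toℕ-inject₁ (fromℕ< i<))
      (trans (toℕ-fromℕ< i<) (sym (toℕ-inner i (<⇒≤ i<)))))) ,
    cong (p P) (toℕ-injective (trans (cong suc (toℕ-fromℕ< i<)) (sym (toℕ-inner (suc i) i<)))))

  link-edge : ∀ {a b} → Link a b → edge (GridUnionJump G P) (embed a) (embed b)
  link-edge right-00 = gridEdge (cell-right 0 0)
  link-edge (right-01 _) = gridEdge (cell-right 0 1)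
  link-edge (jump-first _) =
    subst (λ v → edge (GridUnionJump G P) v (embed (inner 1))) (sym starts) (jump-edge 0 (s≤s z≤n))
  link-edge (jump-inner i _ i<len) = jump-edge i (≤-trans i<len (n≤1+n len))
  link-edge (jump-last c _ refl) = inj₂ (fromℕ len ,
    cong (p P) (toℕ-injective (trans (toℕ-inject₁ (fromℕ len))
      (trans (toℕ-fromℕ len) (sym (toℕ-inner len (n≤1+n len)))))) ,
    sym ends)
  link-edge (jump-direct c len≡0 refl) = inj₂ (fzero , sym starts ,
    trans (cong (p P) (toℕ-injective (trans (cong suc (sym len≡0)) (sym (toℕ-fromℕ (suc len)))))) (sym ends))
  link-edge (right-last c _ _ _ refl) = gridEdge (cell-right lastRow c)
  link-edge (up-lastCol r _ r< refl) = gridEdge (cell-up r< lastCol-odd)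
  link-edge (right-1 c _) = gridEdge (cell-right 1 c)
  link-edge up-3 = gridEdge (cell-up {0} {3} (s≤s z≤n) refl)
  link-edge (right-0 c _ _) = gridEdge (cell-right 0 c)
  link-edge wrap-0 = gridEdge (cell-wrap 0)
  link-edge down-0 = gridEdge (cell-down {0} {0} (s≤s z≤n) refl)
  link-edge wrap-1 = gridEdge (cell-wrap 1)
  link-edge up-1 = gridEdge (cell-up {0} {1} (s≤s z≤n) refl)

  skeleton⊆G∪P : skeleton ⊆G GridUnionJump G P
  skeleton⊆G∪P = skeleton-wellFormed ,
    (λ { v (grid r c , _ , refl) → inj₁ (cell r c , refl)
       ; v (inner i , _ , refl) → inj₂ (i mod suc (suc len) , refl) }) ,
    (λ { u v (a , b , l , refl , refl) → link-edge l })

  NonRoot : Node → Set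
  NonRoot b = b ≢ grid 0 lastCol × b ≢ grid 0 1 × b ≢ grid 1 0

  landing-first : ∀ {c c₀} → c ≡ bp → bp ≤ c₀ → c ≢ suc c₀
  landing-first {c₀ = c₀} refl bp≤c₀ c≡1+c₀ = 1+n≰n (subst (_≤ c₀) c≡1+c₀ bp≤c₀)

  link-in-unique : ∀ {a a' b} → Link a b → Link a' b → NonRoot b → a ≡ a'
  link-in-unique right-00 _ (_ , ≢y , _) = ⊥-elim (≢y refl)
  link-in-unique down-0 _ (_ , _ , ≢z) = ⊥-elim (≢z refl)
  link-in-unique wrap-1 _ (_ , _ , ≢z) = ⊥-elim (≢z refl)
  link-in-unique up-1 _ (_ , ≢y , _) = ⊥-elim (≢y refl)
  link-in-unique (right-01 _) (right-01 _) _ = refl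
  link-in-unique (right-01 _) (right-0 .1 (s≤s ()) _) _
  link-in-unique (right-0 .1 (s≤s ()) _) (right-01 _) _
  link-in-unique (jump-first _) (jump-first _) _ = refl
  link-in-unique (jump-first _) (jump-inner .0 () _) _
  link-in-unique (jump-inner .0 () _) (jump-first _) _
  link-in-unique (jump-inner i _ _) (jump-inner .i _ _) _ = refl
  link-in-unique (jump-last _ _ refl) (jump-last _ _ refl) _ = refl
  link-in-unique (jump-last _ 1≤len _) (jump-direct _ len≡0 _) _ = ⊥-elim (1+n≰n (subst (1 ≤_) len≡0 1≤len))
  link-in-unique (jump-direct _ len≡0 _) (jump-last _ 1≤len _) _ = ⊥-elim (1+n≰n (subst (1 ≤_) len≡0 1≤len))
  link-in-unique (jump-direct _ _ _) (jump-direct _ _ _) _ = refl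
  link-in-unique (jump-last c _ c≡bp) (right-last c₀ _ bp≤c₀ _ c≡1+c₀) _ = ⊥-elim (landing-first c≡bp bp≤c₀ c≡1+c₀)
  link-in-unique (right-last c₀ _ bp≤c₀ _ c≡1+c₀) (jump-last c _ c≡bp) _ = ⊥-elim (landing-first c≡bp bp≤c₀ c≡1+c₀)
  link-in-unique (jump-direct c _ c≡bp) (right-last c₀ _ bp≤c₀ _ c≡1+c₀) _ = ⊥-elim (landing-first c≡bp bp≤c₀ c≡1+c₀)
  link-in-unique (right-last c₀ _ bp≤c₀ _ c≡1+c₀) (jump-direct c _ c≡bp) _ = ⊥-elim (landing-first c≡bp bp≤c₀ c≡1+c₀)
  link-in-unique (jump-last _ _ _) (up-lastCol _ _ r< _) _ = ⊥-elim (<-irrefl refl r<)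
  link-in-unique (up-lastCol _ _ r< _) (jump-last _ _ _) _ = ⊥-elim (<-irrefl refl r<)
  link-in-unique (jump-direct _ _ _) (up-lastCol _ _ r< _) _ = ⊥-elim (<-irrefl refl r<)
  link-in-unique (up-lastCol _ _ r< _) (jump-direct _ _ _) _ = ⊥-elim (<-irrefl refl r<)
  link-in-unique (right-last _ _ _ _ refl) (right-last _ _ _ _ refl) _ = refl
  link-in-unique (right-last _ _ _ _ _) (up-lastCol _ _ r< _) _ = ⊥-elim (<-irrefl refl r<)
  link-in-unique (up-lastCol _ _ r< _) (right-last _ _ _ _ _) _ = ⊥-elim (<-irrefl refl r<)
  link-in-unique (up-lastCol _ _ _ refl) (up-lastCol _ _ _ refl) _ = refl
  link-in-unique (up-lastCol _ _ _ _) (right-0 _ _ _) (≢x , _) = ⊥-elim (≢x refl)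
  link-in-unique (right-0 _ _ _) (up-lastCol _ _ _ _) (≢x , _) = ⊥-elim (≢x refl)
  link-in-unique (up-lastCol _ _ _ _) (right-1 _ (s≤s (s≤s (s≤s ())))) _
  link-in-unique (right-1 _ (s≤s (s≤s (s≤s ())))) (up-lastCol _ _ _ _) _
  link-in-unique (right-1 _ _) (right-1 _ _) _ = refl
  link-in-unique up-3 up-3 _ = refl
  link-in-unique up-3 (right-0 .2 (s≤s (s≤s ())) _) _
  link-in-unique (right-0 .2 (s≤s (s≤s ())) _) up-3 _
  link-in-unique (right-0 _ _ _) (right-0 _ _ _) _ = refl
  link-in-unique wrap-0 wrap-0 _ = refl

  x y z : Node
  x = grid 0 lastCol
  y = grid 0 1
  z = grid 1 0

  open ForestContraction (_≟_ {N}) skeleton skeleton-wellFormed (embed x) (embed y) (embed z)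

  x-inRange : InRange x
  x-inRange = z≤n , ≤-refl
  y-inRange : InRange y
  y-inRange = z≤n , small (s≤s z≤n)
  z-inRange : InRange z
  z-inRange = 1≤lastRow , z≤n

  nonRoot-embed : ∀ w → InRange w → NonRoot w → ¬ Root (embed w)
  nonRoot-embed w w-in (≢x , _ , _) (inj₁ eq) = ≢x (embed-injective _ _ w-in x-inRange eq)
  nonRoot-embed w w-in (_ , ≢y , _) (inj₂ (inj₁ eq)) = ≢y (embed-injective _ _ w-in y-inRange eq)
  nonRoot-embed w w-in (_ , _ , ≢z) (inj₂ (inj₂ eq)) = ≢z (embed-injective _ _ w-in z-inRange eq)

  embed-nonRoot : ∀ w → ¬ Root (embed w) → NonRoot w
  embed-nonRoot w not-root = (λ { refl → not-root (inj₁ refl) }) , (λ { refl → not-root (inj₂ (inj₁ refl)) }) ,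
                             (λ { refl → not-root (inj₂ (inj₂ refl)) })

  in-degree-one : InDegreeOne
  in-degree-one w not-root u u' (a , b , l , refl , refl) (a' , b' , l' , refl , b'≡b)
    with embed-injective b' b (proj₂ (link-inRange l')) (proj₂ (link-inRange l)) b'≡b
  ... | refl = cong embed (link-in-unique l l' (embed-nonRoot b not-root))

  link : ∀ {a b} → Link a b → edge skeleton (embed a) (embed b)
  link {a} {b} l = a , b , l , refl , refl

  row0-nonRoot : ∀ c → c < lastCol → c ≢ 1 → ¬ Root (embed (grid 0 c))
  row0-nonRoot c c< c≢1 = nonRoot-embed (grid 0 c) (z≤n , <⇒≤ c<)
    ((λ { refl → <-irrefl refl c< }) , (λ { refl → c≢1 refl }) , λ ())

  row1-nonRoot : ∀ c → 1 ≤ c → c ≤ lastCol → ¬ Root (embed (grid 1 c))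
  row1-nonRoot (suc c) _ c≤ = nonRoot-embed (grid 1 (suc c)) (1≤lastRow , c≤) ((λ ()) , (λ ()) , λ ())

  lastRow-nonRoot : ∀ c → c ≤ lastCol → ¬ Root (embed (grid lastRow c))
  lastRow-nonRoot c c≤ = nonRoot-embed (grid lastRow c) (≤-refl , c≤) ((λ ()) , (λ ()) , λ ())

  lastCol-nonRoot : ∀ r → 1 ≤ r → r ≤ lastRow → ¬ Root (embed (grid r lastCol))
  lastCol-nonRoot (suc r) _ r≤ = nonRoot-embed (grid (suc r) lastCol) (r≤ , ≤-refl) ((λ ()) , (λ ()) , λ ())

  inner-nonRoot : ∀ i → 1 ≤ i → i ≤ len → ¬ Root (embed (inner i))
  inner-nonRoot i 1≤i i≤ = nonRoot-embed (inner i) (1≤i , i≤) ((λ ()) , (λ ()) , λ ())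

  row0 row1 jumpAt bottomAt climb : ℕ → Fin N
  row0 c = embed (grid 0 c)
  row1 c = embed (grid 1 c)
  jumpAt i = embed (inner i)
  bottomAt c = embed (grid lastRow c)
  climb i = embed (grid (lastRow ∸ i) lastCol)

  yStart : d ≡ 1 ⊎ d ≡ 2 → List (Fin N)
  yStart (inj₁ _) = []
  yStart (inj₂ _) = row0 2 ∷ []

  xBranch zRow1 zRow0 yJump yLastRow yLastCol mergeList : List (Fin N)
  xBranch = segment row0 0 1
  zRow1 = segment row1 1 3
  zRow0 = segment row0 3 (suc (suc (j + j)))
  yJump = segment jumpAt 1 len
  yLastRow = segment bottomAt bp (suc lastCol ∸ bp)
  yLastCol = segment climb 1 (suc j)
  mergeList = xBranch ++ zRow1 ++ zRow0 ++ yStart d∈1,2 ++ yJump ++ yLastRow ++ yLastCol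

  bp+rest : bp + (suc lastCol ∸ bp) ≡ suc lastCol
  bp+rest = m+[n∸m]≡n (≤-trans bp≤ (n≤1+n lastCol))

  ≥3⇒≢1 : ∀ {c} → 3 ≤ c → c ≢ 1
  ≥3⇒≢1 (s≤s (s≤s (s≤s _))) ()

  start-ready : ∀ {S : Fin N → Set} → (d ≡ 2 → S (row0 2)) → Root (row0 d) ⊎ S (row0 d)
  start-ready {S} ready with d∈1,2
  ... | inj₁ d≡1 = inj₁ (inj₂ (inj₁ (cong row0 d≡1)))
  ... | inj₂ d≡2 = inj₂ (subst (S ∘ row0) (sym d≡2) (ready d≡2))

  xBranch-order : ∀ {S} → MergeOrder S xBranch
  xBranch-order = segment-mergeOrder row0 0 1
    (λ { zero _ _ → row0-nonRoot 0 (s≤s z≤n) (λ ()) ; (suc _) _ (s≤s ()) })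
    (λ _ → embed x , link wrap-0 , inj₁ (inj₁ refl))
    (λ { _ _ (s≤s ()) })

  zRow1-order : ∀ {S} → MergeOrder S zRow1
  zRow1-order = segment-mergeOrder row1 1 3
    (λ c 1≤c c<4 → row1-nonRoot c 1≤c (small (≤-trans (≤-pred c<4) (m≤m+n 3 2))))
    (λ _ → embed z , link (right-1 0 (s≤s z≤n)) , inj₁ (inj₂ (inj₂ refl)))
    (λ c _ 1+c<4 → link (right-1 c (≤-pred 1+c<4)))

  zRow0-order : ∀ {S} → S (row1 3) → MergeOrder S zRow0
  zRow0-order ready = segment-mergeOrder row0 3 (suc (suc (j + j)))
    (λ c 3≤c c< → row0-nonRoot c c< (≥3⇒≢1 3≤c))
    (λ _ → row1 3 , link up-3 , inj₂ ready)
    (λ c 3≤c 1+c< → link (right-0 c 3≤c (<⇒≤ 1+c<)))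

  yStart-order : ∀ {S} e → MergeOrder S (yStart e)
  yStart-order (inj₁ _) = []
  yStart-order (inj₂ d≡2) =
    (row0-nonRoot 2 (small (m≤m+n 3 2)) (λ ()) , embed y , link (right-01 d≡2) , inj₁ (inj₂ (inj₁ refl))) ∷ []

  yJump-order : ∀ {S} → (d ≡ 2 → S (row0 2)) → MergeOrder S yJump
  yJump-order {S} ready = segment-mergeOrder jumpAt 1 len
    (λ i 1≤i i< → inner-nonRoot i 1≤i (≤-pred i<))
    (λ 1≤len → row0 d , link (jump-first 1≤len) , start-ready {S} ready)
    (λ i 1≤i 1+i< → link (jump-inner i 1≤i (≤-pred 1+i<)))

  yLastRow-order : ∀ {S} → (d ≡ 2 → S (row0 2)) → (1 ≤ len → S (jumpAt len)) → MergeOrder S yLastRow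
  yLastRow-order {S} ready ready′ = segment-mergeOrder bottomAt bp (suc lastCol ∸ bp)
    (λ c _ c< → lastRow-nonRoot c (≤-pred (subst (c <_) bp+rest c<)))
    (λ _ → landing len refl)
    (λ c bp≤c 1+c< → link (right-last c (suc c) bp≤c (≤-pred (subst (suc c <_) bp+rest 1+c<)) refl))
    where
    landing : ∀ l → l ≡ len → Σ (Fin N) λ u → edge skeleton u (bottomAt bp) × (Root u ⊎ S u)
    landing zero len≡0 = row0 d , link (jump-direct bp (sym len≡0) refl) , start-ready {S} ready
    landing (suc l) refl = jumpAt len , link (jump-last bp (s≤s z≤n) refl) , inj₂ (ready′ (s≤s z≤n))

  yLastCol-order : ∀ {S} → S (bottomAt lastCol) → MergeOrder S yLastCol
  yLastCol-order ready = segment-mergeOrder climb 1 (suc j)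
    (λ i _ i< → lastCol-nonRoot (lastRow ∸ i) (m<n⇒0<n∸m i<) (m∸n≤m lastRow i))
    (λ _ → bottomAt lastCol , link (up-lastCol (suc j) lastRow ≤-refl refl) , inj₂ ready)
    (λ i _ 1+i< → link (up-lastCol (lastRow ∸ suc i) (lastRow ∸ i) (s≤s (m∸n≤m (suc j) i))
                          (+-∸-assoc 1 (<⇒≤ 1+i<))))

  row1-3∈zRow1 : row1 3 ∈ zRow1
  row1-3∈zRow1 = ∈-segment row1 1 3 3 (s≤s z≤n) ≤-refl

  row0-2∈yStart : d ≡ 2 → row0 2 ∈ yStart d∈1,2
  row0-2∈yStart d≡2 with d∈1,2
  ... | inj₁ d≡1 = ⊥-elim (1+n≢n (trans (sym d≡2) d≡1))
  ... | inj₂ _ = here refl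

  jumpAt-len∈yJump : 1 ≤ len → jumpAt len ∈ yJump
  jumpAt-len∈yJump 1≤len = ∈-segment jumpAt 1 len len 1≤len ≤-refl

  bottomAt∈yLastRow : ∀ c → bp ≤ c → c ≤ lastCol → bottomAt c ∈ yLastRow
  bottomAt∈yLastRow c bp≤c c≤ =
    ∈-segment bottomAt bp (suc lastCol ∸ bp) c bp≤c (subst (c <_) (sym bp+rest) (s≤s c≤))

  mergeList-order : MergeOrder (λ _ → ⊥) mergeList
  mergeList-order =
    mergeOrder-++ xBranch xBranch-order λ _ _ →
    mergeOrder-++ zRow1 zRow1-order λ _ zRow1⊆ →
    mergeOrder-++ zRow0 (zRow0-order (zRow1⊆ _ row1-3∈zRow1)) λ _ _ →
    mergeOrder-++ (yStart d∈1,2) (yStart-order d∈1,2) λ _ yStart⊆ →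
    mergeOrder-++ yJump (yJump-order (λ d≡2 → yStart⊆ _ (row0-2∈yStart d≡2))) λ earlier yJump⊆ →
    mergeOrder-++ yLastRow
      (yLastRow-order (λ d≡2 → earlier _ (yStart⊆ _ (row0-2∈yStart d≡2)))
                      (λ 1≤len → yJump⊆ _ (jumpAt-len∈yJump 1≤len)))
      λ _ yLastRow⊆ →
    yLastCol-order (yLastRow⊆ _ (bottomAt∈yLastRow lastCol bp≤ ≤-refl))

  Covered : Fin N → Set
  Covered v = Root v ⊎ v ∈ mergeList

  module _ {v : Fin N} where
    in-zRow1 : v ∈ zRow1 → v ∈ mergeList
    in-zRow1 m = ∈-++⁺ʳ xBranch (∈-++⁺ˡ m)
    in-zRow0 : v ∈ zRow0 → v ∈ mergeList
    in-zRow0 m = ∈-++⁺ʳ xBranch (∈-++⁺ʳ zRow1 (∈-++⁺ˡ m))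
    in-yStart : v ∈ yStart d∈1,2 → v ∈ mergeList
    in-yStart m = ∈-++⁺ʳ xBranch (∈-++⁺ʳ zRow1 (∈-++⁺ʳ zRow0 (∈-++⁺ˡ m)))
    in-yJump : v ∈ yJump → v ∈ mergeList
    in-yJump m = ∈-++⁺ʳ xBranch (∈-++⁺ʳ zRow1 (∈-++⁺ʳ zRow0 (∈-++⁺ʳ (yStart d∈1,2) (∈-++⁺ˡ m))))
    in-yLastRow : v ∈ yLastRow → v ∈ mergeList
    in-yLastRow m = ∈-++⁺ʳ xBranch (∈-++⁺ʳ zRow1 (∈-++⁺ʳ zRow0 (∈-++⁺ʳ (yStart d∈1,2) (∈-++⁺ʳ yJump (∈-++⁺ˡ m)))))
    in-yLastCol : v ∈ yLastCol → v ∈ mergeList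
    in-yLastCol m = ∈-++⁺ʳ xBranch (∈-++⁺ʳ zRow1 (∈-++⁺ʳ zRow0 (∈-++⁺ʳ (yStart d∈1,2) (∈-++⁺ʳ yJump (∈-++⁺ʳ yLastRow m)))))

  x-covered : Covered (embed x)
  x-covered = inj₁ (inj₁ refl)
  y-covered : Covered (embed y)
  y-covered = inj₁ (inj₂ (inj₁ refl))
  z-covered : Covered (embed z)
  z-covered = inj₁ (inj₂ (inj₂ refl))

  corner-covered : Covered (row0 0)
  corner-covered = inj₂ (here refl)

  row0-covered : ∀ c → 3 ≤ c → c < lastCol → Covered (row0 c)
  row0-covered c 3≤c c< = inj₂ (in-zRow0 (∈-segment row0 3 (suc (suc (j + j))) c 3≤c c<))

  row1-covered : ∀ c → c ≤ 3 → Covered (row1 c)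
  row1-covered zero _ = z-covered
  row1-covered (suc c) c≤3 = inj₂ (in-zRow1 (∈-segment row1 1 3 (suc c) (s≤s z≤n) (s≤s c≤3)))

  start-covered : Covered (row0 d)
  start-covered = start-ready {S = _∈ mergeList} (λ d≡2 → in-yStart (row0-2∈yStart d≡2))

  jump-covered : ∀ i → 1 ≤ i → i ≤ len → Covered (jumpAt i)
  jump-covered i 1≤i i≤ = inj₂ (in-yJump (∈-segment jumpAt 1 len i 1≤i (s≤s i≤)))

  bottom-covered : ∀ c → bp ≤ c → c ≤ lastCol → Covered (bottomAt c)
  bottom-covered c bp≤c c≤ = inj₂ (in-yLastRow (bottomAt∈yLastRow c bp≤c c≤))

  lastCol-covered : ∀ r → r ≤ lastRow → Covered (embed (grid r lastCol))
  lastCol-covered zero _ = x-covered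
  lastCol-covered (suc r) r≤ with m≤n⇒m<n∨m≡n r≤
  ... | inj₁ r< = inj₂ (in-yLastCol (subst (λ t → embed (grid t lastCol) ∈ yLastCol) (m∸[m∸n]≡n (<⇒≤ r<))
                    (∈-segment climb 1 (suc j) (lastRow ∸ suc r) (m<n⇒0<n∸m r<) (s≤s (m∸n≤m (suc j) r)))))
  ... | inj₂ refl = bottom-covered lastCol bp≤ ≤-refl

  source-covered : ∀ {a b} → Link a b → Covered (embed a)
  source-covered right-00 = corner-covered
  source-covered (right-01 _) = y-covered
  source-covered (jump-first _) = start-covered
  source-covered (jump-inner i 1≤i 1+i≤) = jump-covered i 1≤i (≤-trans (n≤1+n i) 1+i≤)
  source-covered (jump-last _ 1≤len _) = jump-covered len 1≤len ≤-refl
  source-covered (jump-direct _ _ _) = start-covered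
  source-covered (right-last c _ bp≤c c< _) = bottom-covered c bp≤c (<⇒≤ c<)
  source-covered (up-lastCol r _ r< refl) = lastCol-covered (suc r) r<
  source-covered (right-1 c c<3) = row1-covered c (<⇒≤ c<3)
  source-covered up-3 = row1-covered 3 ≤-refl
  source-covered (right-0 c 3≤c c<) = row0-covered c 3≤c c<
  source-covered wrap-0 = x-covered
  source-covered down-0 = corner-covered
  source-covered wrap-1 = lastCol-covered 1 1≤lastRow
  source-covered up-1 = row1-covered 1 (s≤s z≤n)

  target-covered : ∀ {a b} → Link a b → Covered (embed b)
  target-covered right-00 = y-covered
  target-covered (right-01 d≡2) = inj₂ (in-yStart (row0-2∈yStart d≡2))
  target-covered (jump-first 1≤len) = jump-covered 1 ≤-refl 1≤len
  target-covered (jump-inner i _ 1+i≤) = jump-covered (suc i) (s≤s z≤n) 1+i≤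
  target-covered (jump-last _ _ refl) = bottom-covered bp ≤-refl bp≤
  target-covered (jump-direct _ _ refl) = bottom-covered bp ≤-refl bp≤
  target-covered (right-last c _ bp≤c c< refl) = bottom-covered (suc c) (≤-trans bp≤c (n≤1+n c)) c<
  target-covered (up-lastCol r _ r< refl) = lastCol-covered r (<⇒≤ r<)
  target-covered (right-1 c c<3) = row1-covered (suc c) c<3
  target-covered up-3 = row0-covered 3 ≤-refl (s≤s (s≤s (s≤s (s≤s z≤n))))
  target-covered (right-0 c 3≤c c<) with m≤n⇒m<n∨m≡n c<
  ... | inj₁ 1+c< = row0-covered (suc c) (≤-trans 3≤c (n≤1+n c)) 1+c<
  ... | inj₂ refl = x-covered
  target-covered wrap-0 = corner-covered
  target-covered down-0 = z-covered
  target-covered wrap-1 = z-covered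
  target-covered up-1 = y-covered

  skeleton-covered : ∀ v → vert skeleton v → Covered v
  skeleton-covered v (w , (w' , inj₁ l) , refl) = source-covered l
  skeleton-covered v (w , (w' , inj₂ l) , refl) = target-covered l

  corner-path : RootPath (row0 0) (embed x)
  corner-path = step (row0-nonRoot 0 (s≤s z≤n) (λ ())) (link wrap-0) (root (embed x) (inj₁ refl))

  row1-path : ∀ c → c ≤ 3 → RootPath (row1 c) (embed z)
  row1-path c c≤3 = rootPath-along row1 0 c
    (λ i _ i<c → link (right-1 i (≤-trans i<c c≤3)) ,
                 row1-nonRoot (suc i) (s≤s z≤n) (small (≤-trans i<c (≤-trans c≤3 (m≤m+n 3 2)))))
    (root (embed z) (inj₂ (inj₂ refl)))

  beforeLastCol-path : RootPath (row0 (3 + suc (j + j))) (embed z)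
  beforeLastCol-path = rootPath-along row0 3 (suc (j + j))
    (λ i 3≤i i< → link (right-0 i 3≤i (≤-trans i< (n≤1+n _))) ,
                  row0-nonRoot (suc i) (s≤s i<) (≥3⇒≢1 (≤-trans 3≤i (n≤1+n i))))
    (step (row0-nonRoot 3 (small (m≤m+n 4 1)) (λ ())) (link up-3) (row1-path 3 ≤-refl))

  start-path : RootPath (row0 d) (embed y)
  start-path with d∈1,2
  ... | inj₁ d≡1 = subst (λ t → RootPath (row0 t) (embed y)) (sym d≡1) (root (embed y) (inj₂ (inj₁ refl)))
  ... | inj₂ d≡2 = subst (λ t → RootPath (row0 t) (embed y)) (sym d≡2)
                     (step (row0-nonRoot 2 (small (m≤m+n 3 2)) (λ ())) (link (right-01 d≡2))
                           (root (embed y) (inj₂ (inj₁ refl))))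

  jump-path : ∀ l → suc l ≤ len → RootPath (jumpAt (suc l)) (embed y)
  jump-path l 1+l≤len = rootPath-along jumpAt 1 l
    (λ i 1≤i i< → link (jump-inner i 1≤i (≤-trans i< 1+l≤len)) ,
                  inner-nonRoot (suc i) (s≤s z≤n) (≤-trans i< 1+l≤len))
    (step (inner-nonRoot 1 ≤-refl 1≤len) (link (jump-first 1≤len)) start-path)
    where
    1≤len : 1 ≤ len
    1≤len = ≤-trans (s≤s z≤n) 1+l≤len

  landing-path : RootPath (bottomAt bp) (embed y)
  landing-path = from len refl
    where
    from : ∀ l → l ≡ len → RootPath (bottomAt bp) (embed y)
    from zero 0≡len = step (lastRow-nonRoot bp bp≤) (link (jump-direct bp (sym 0≡len) refl)) start-path
    from (suc l) 1+l≡len = step (lastRow-nonRoot bp bp≤) (link (jump-last bp (subst (1 ≤_) 1+l≡len (s≤s z≤n)) refl))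
      (subst (λ t → RootPath (jumpAt t) (embed y)) 1+l≡len (jump-path l (≤-reflexive 1+l≡len)))

  bottomCorner-path : RootPath (bottomAt lastCol) (embed y)
  bottomCorner-path = subst (λ t → RootPath (bottomAt t) (embed y)) (m+[n∸m]≡n bp≤)
    (rootPath-along bottomAt bp (lastCol ∸ bp)
      (λ c bp≤c c< → let 1+c≤ = subst (c <_) (m+[n∸m]≡n bp≤) c< in
                      link (right-last c (suc c) bp≤c 1+c≤ refl) , lastRow-nonRoot (suc c) 1+c≤)
      landing-path)

  lastCol1-path : RootPath (embed (grid 1 lastCol)) (embed y)
  lastCol1-path = subst (λ t → RootPath (embed (grid t lastCol)) (embed y)) (m+n∸n≡m 1 j)
    (rootPath-along climb 0 (suc j)
      (λ i _ i< → link (up-lastCol (lastRow ∸ suc i) (lastRow ∸ i) (s≤s (m∸n≤m (suc j) i)) (+-∸-assoc 1 (<⇒≤ i<))) ,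
                  lastCol-nonRoot (lastRow ∸ suc i) (m<n⇒0<n∸m (s≤s i<)) (m∸n≤m lastRow (suc i)))
      bottomCorner-path)

  x∈skeleton : vert skeleton (embed x)
  x∈skeleton = x , (grid 0 0 , inj₁ wrap-0) , refl
  y∈skeleton : vert skeleton (embed y)
  y∈skeleton = y , (grid 0 0 , inj₂ right-00) , refl
  z∈skeleton : vert skeleton (embed z)
  z∈skeleton = z , (grid 0 0 , inj₂ down-0) , refl

  x≢y : embed x ≢ embed y
  x≢y eq with embed-injective x y x-inRange y-inRange eq
  ... | ()
  y≢z : embed y ≢ embed z
  y≢z eq with embed-injective y z y-inRange z-inRange eq
  ... | ()
  x≢z : embed x ≢ embed z
  x≢z eq with embed-injective x z x-inRange z-inRange eq
  ... | ()

  weakOddBicycle : ContainsWeakOddBicycle _≟_ (GridUnionJump G P)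
  weakOddBicycle = skeleton , result , skeleton⊆G∪P , contracts ,
    isOddBicycle-resp-≃ᴳ result≃ (quotient-isOddBicycle in-degree-one merges consistent merged-or-root
      x∈skeleton y∈skeleton z∈skeleton x≢y y≢z x≢z
      (row0 0 , link right-00 , corner-path)
      (row0 0 , link down-0 , corner-path)
      (embed (grid 1 lastCol) , link (up-lastCol 0 1 (s≤s z≤n) refl) , lastCol1-path)
      (embed (grid 1 lastCol) , link wrap-1 , lastCol1-path)
      (row0 (3 + suc (j + j)) , link (right-0 _ (s≤s (s≤s (s≤s z≤n))) ≤-refl) , beforeLastCol-path)
      (row1 1 , link up-1 , row1-path 1 (s≤s z≤n)))
    where
    contraction : ContractionOf skeleton [] mergeList
    contraction = contractAlong in-degree-one mergeList [] skeleton
                    (quotient-id skeleton-wellFormed) tt (λ _ ()) mergeList-order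
    open ContractionOf contraction
    merged-or-root : ∀ a → vert skeleton a → Root a ⊎ Merged a merges
    merged-or-root a a∈ with skeleton-covered a a∈
    ... | inj₁ a-root = inj₁ a-root
    ... | inj₂ a∈list = inj₂ (covers a a∈list)

C₁-isEven : ∀ {N ED m} (G : GridIn N ED (suc m)) (P : PerimeterJump G) → ContainsEvenDicycle (GridUnionJump G P)
C₁-isEven {m = m} G P = m , (λ i → φ G (fzero , i)) , s≤s z≤n ,
  (λ i i' eq → cong proj₂ (φ-inj G _ _ eq)) ,
  (λ i → inj₁ ((fzero , i) , refl)) ,
  (λ i i' i→i' → inj₁ ((fzero , i) , (fzero , i') , inj₁ (refl , i→i') , refl , refl))

lemma4p1 : (k : ℕ) → 3 ≤ k → (N : ℕ) (ED : Fin N → Fin N → Set)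
    → (G : GridIn N ED k) (P : PerimeterJump G)
    → ContainsWeakOddBicycle _≟_ (GridUnionJump G P)
      × ContainsEvenDicycle (GridUnionJump G P)
lemma4p1 (suc (suc (suc j))) (s≤s (s≤s (s≤s z≤n))) N ED G P =
  Pattern.weakOddBicycle j (GridFrame.jumpAligned j G P) , C₁-isEven G P
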